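{- For every composition $\alpha$, the coproduct of $\mathrm{QSym}$ satisfies $\Delta(S_\alpha)=\sum_{\beta\gamma=\alpha}S_\beta\otimes S_\gamma$, the sum being over all pairs of (possibly empty) compositions $\beta,\gamma$ whose concatenation is $\alpha$ (with $S_{()}=1$).
   Context: A composition $\alpha\models n$ is a finite sequence $(\alpha_1,\dots,\alpha_\ell)$ of positive integers with sum $n$; $\ell(\alpha)=\ell$; $()$ is the empty composition. For $\alpha\models n$ let $\mathcal{I}(\alpha)=\{\alpha_1,\alpha_1+\alpha_2,\dots,\alpha_1+\cdots+\alpha_{\ell-1}\}$; for $\alpha,\beta\models n$ write $\beta\leq\alpha$ if $\mathcal{I}(\beta)\subseteq\mathcal{I}(\alpha)$. $\mathrm{QSym}$ is the Hopf algebra of quasisymmetric functions with basis $M_\alpha=\sum_{i_1<\cdots<i_\ell}x_{i_1}^{\alpha_1}\cdots x_{i_\ell}^{\alpha_\ell}$ ($M_{()}=1$) and coproduct $\Delta(M_\alpha)=\sum_{\beta\gamma=\alpha}M_\beta\otimes M_\gamma$ (deconcatenation). For $\alpha=(\alpha_1,\dots,\alpha_\ell)$, let $\mathrm{OtE}(\alpha)=\{i:\alpha_i\text{ odd},\alpha_{i+1}\text{ even}\}$; if $\mathrm{OtE}(\alpha)=\{i_1<\cdots<i_k\}$, set $m_o(\alpha)=(\alpha_1+\cdots+\alpha_{i_1},\alpha_{i_1+1}+\cdots+\alpha_{i_2},\dots,\alpha_{i_k+1}+\cdots+\alpha_\ell)$. For $\beta$ with $m_o(\alpha)\leq\beta\leq\alpha$,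 each $\beta_i=\alpha_j+\cdots+\alpha_{j+k}$ is a sum of consecutive parts of $\alpha$; let $\mathrm{O}_\alpha^\beta(i)$, $\mathrm{E}_\alpha^\beta(i)$ be the numbers of odd and even entries among $\alpha_j,\dots,\alpha_{j+k}$, and $c_\alpha^\beta=\prod_i \frac{1}{\mathrm{O}_\alpha^\beta(i)!\,\mathrm{E}_\alpha^\beta(i)!}$. The shuffle function is $S_\alpha=\sum_{m_o(\alpha)\leq\beta\leq\alpha}c_\alpha^\beta M_\beta$. -}

module Defs where

open import Data.Bool using (Bool; true; false; if_then_else_; _∧_; not)
open import Data.Nat using (ℕ; zero; suc; _+_; _*_; _∸_; _≤ᵇ_; _<_; _≡ᵇ_)
open import Data.Nat.Properties using (_!*_!≢0)
open import Data.Nat using (_!)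
open import Data.List using (List; []; _∷_; [_]; map; concatMap; filterᵇ; foldr; length; _++_)
open import Data.Nat.ListAction using (sum)
open import Data.Product using (_×_; _,_; proj₁; proj₂)
open import Data.Integer using () renaming (+_ to ℤ+_)
open import Data.Rational using (ℚ; 0ℚ; 1ℚ) renaming (_+_ to _+ℚ_; _*_ to _*ℚ_; _/_ to _/ℚ_)

-- Compositions: lists of natural numbers; positivity of parts is
-- imposed as a hypothesis (All (0 <_)) where needed.

Comp : Set
Comp = List ℕ

isOdd : ℕ → Bool
isOdd zero = false
isOdd (suc n) = not (isOdd n)

isEven : ℕ → Bool
isEven n = not (isOdd n)

_≡ᶜ_ : Comp → Comp → Bool
[] ≡ᶜ [] = true
[] ≡ᶜ (_ ∷ _) = false
(_ ∷ _) ≡ᶜ [] = false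
(a ∷ as) ≡ᶜ (b ∷ bs) = (a ≡ᵇ b) ∧ (as ≡ᶜ bs)

incFirst : Comp → Comp
incFirst [] = []
incFirst (a ∷ r) = suc a ∷ r

comps : ℕ → List Comp
comps zero = [] ∷ []
comps (suc zero) = (1 ∷ []) ∷ []
comps (suc (suc n)) = concatMap (λ c → (1 ∷ c) ∷ incFirst c ∷ []) (comps (suc n))

descentSet : Comp → List ℕ
descentSet [] = []
descentSet (a ∷ []) = []
descentSet (a ∷ b ∷ r) = a ∷ map (a +_) (descentSet (b ∷ r))

memᵇ : ℕ → List ℕ → Bool
memᵇ x [] = false
memᵇ x (y ∷ ys) = if x ≡ᵇ y then true else memᵇ x ys

allᵇ : (ℕ → Bool) → List ℕ → Bool
allᵇ p [] = true
allᵇ p (x ∷ xs) = p x ∧ allᵇ p xs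

_≤ᶜ_ : Comp → Comp → Bool
β ≤ᶜ α = (sum β ≡ᵇ sum α) ∧ allᵇ (λ x → memᵇ x (descentSet α)) (descentSet β)

-- m_o(α): cut exactly after positions i with α_i odd and α_{i+1} even,
-- merging all other consecutive parts.
mo : Comp → Comp
mo [] = []
mo (a ∷ []) = a ∷ []
mo (a ∷ b ∷ r) with mo (b ∷ r)
... | [] = a ∷ []
... | c ∷ cs = if isOdd a ∧ isEven b then a ∷ c ∷ cs else (a + c) ∷ cs

-- grouping the parts of α into consecutive blocks with sums β₁, β₂, …
-- (correct whenever β ≤ α)
takeBlock : ℕ → List ℕ → List ℕ × List ℕ
takeBlock t [] = [] , []
takeBlock t (a ∷ r) with t ≤ᵇ a
... | true = (a ∷ []) , r
... | false with takeBlock (t ∸ a) r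
...   | (b , r') = (a ∷ b) , r'

blocks : Comp → Comp → List (List ℕ)
blocks α [] = []
blocks α (b ∷ β) with takeBlock b α
... | (x , α') = x ∷ blocks α' β

countOdd countEven : List ℕ → ℕ
countOdd xs = length (filterᵇ isOdd xs)
countEven xs = length (filterᵇ isEven xs)

blockCoeff : List ℕ → ℚ
blockCoeff xs = ((ℤ+ 1) /ℚ (countOdd xs ! * countEven xs !)) {{countOdd xs !* countEven xs !≢0}}

coeffC : Comp → Comp → ℚ
coeffC α β = foldr (λ xs q → blockCoeff xs *ℚ q) 1ℚ (blocks α β)

-- Elements of QSym: finite formal ℚ-linear combinations of the M_β
-- (a list of (coefficient, β) meaning Σ coeff · M_β).
-- Elements of QSym ⊗ QSym: Σ coeff · M_β ⊗ M_γ.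

QSymElt : Set
QSymElt = List (ℚ × Comp)

QSym⊗QSymElt : Set
QSym⊗QSymElt = List (ℚ × Comp × Comp)

coeff : QSymElt → Comp → ℚ
coeff f β = foldr (λ p q → (if proj₂ p ≡ᶜ β then proj₁ p else 0ℚ) +ℚ q) 0ℚ f

coeff₂ : QSym⊗QSymElt → Comp → Comp → ℚ
coeff₂ f β γ =
  foldr (λ p q → (if (proj₁ (proj₂ p) ≡ᶜ β) ∧ (proj₂ (proj₂ p) ≡ᶜ γ) then proj₁ p else 0ℚ) +ℚ q) 0ℚ f

deconcat : Comp → List (Comp × Comp)
deconcat [] = ([] , []) ∷ []
deconcat (a ∷ r) = ([] , a ∷ r) ∷ map (λ p → (a ∷ proj₁ p) , proj₂ p) (deconcat r)

Δ : QSymElt → QSym⊗QSymElt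
Δ f = concatMap (λ p → map (λ d → proj₁ p , proj₁ d , proj₂ d) (deconcat (proj₂ p))) f

_⊗_ : QSymElt → QSymElt → QSym⊗QSymElt
f ⊗ g = concatMap (λ p → map (λ q → (proj₁ p *ℚ proj₁ q) , proj₂ p , proj₂ q) g) f

S : Comp → QSymElt
S α = map (λ β → coeffC α β , β)
          (filterᵇ (λ β → (mo α ≤ᶜ β) ∧ (β ≤ᶜ α)) (comps (sum α)))

deconcatS : Comp → QSym⊗QSymElt
deconcatS α = concatMap (λ d → S (proj₁ d) ⊗ S (proj₂ d)) (deconcat α)

-- Taking coefficients, Δ(S α) has coefficient c_α^{βγ} at M_β ⊗ M_γ when βγ lies in the
-- support of S α, while the right-hand side collects c_{α₁}^β c_{α₂}^γ over the
-- factorisations α = α₁α₂.  The support {m_o(α) ≤ δ ≤ α} consists of the coarsenings of α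
-- keeping all odd-to-even cuts.  A coarsening βγ of α₁α₂ with |β| = |α₁| is exactly a
-- coarsening β of α₁ followed by a coarsening γ of α₂; the odd-to-even cut between α₁ and
-- α₂ is then kept automatically.  As c is a product over the blocks of the coarsening, it is
-- multiplicative under this splitting.  Finally, positive parts have distinct prefix sums,
-- so at most one factorisation α = α₁α₂ has |α₁| = |β|, and one does when βγ is in the support.
module Submission where

open import Defs
open import Data.Bool using (Bool; true; false; if_then_else_; _∧_; _∨_; not)
open import Data.Bool.Properties using (T-≡; ∧-zeroʳ; ∧-assoc; ∨-zeroʳ; not-¬; ¬-not)
open import Data.Empty using (⊥-elim)
open import Data.List using (List; []; _∷_; _++_; map; concat; concatMap; filterᵇ; foldr; replicate; length)
open import Data.List.Membership.Propositional using (_∈_)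
open import Data.List.Membership.Propositional.Properties using (∈-map⁺; ∈-map⁻)
open import Data.List.Properties using (map-cong; map-∘; ++-identityʳ; ++-assoc; ∷-injective; concat-++)
open import Data.List.Relation.Binary.Subset.Propositional using (_⊆_)
open import Data.List.Relation.Unary.All using (All; []; _∷_; universal)
import Data.List.Relation.Unary.All as All
import Data.List.Relation.Unary.All.Properties as All
open import Data.List.Relation.Unary.Any using (here; there)
open import Data.Nat using (ℕ; zero; suc; _+_; _∸_; _<_; _≤_; _≡ᵇ_; _≤ᵇ_; s≤s; z≤n)
open import Data.Nat.ListAction using (sum)
open import Data.Nat.ListAction.Properties using (sum-++)
open import Data.Nat.Properties
  using (≡ᵇ⇒≡; ≡⇒≡ᵇ; ≤⇒≤ᵇ; ≤ᵇ⇒≤; +-assoc; +-identityʳ; +-cancelˡ-≡; +-cancelʳ-≡; ≤-refl; ≤-trans;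
         <-≤-trans; <⇒≢; <⇒≱; m≤m+n; m≤n+m; m<m+n; m+n∸m≡n; m+n≡0⇒m≡0; +-commutativeSemigroup)
open import Algebra.Properties.CommutativeSemigroup +-commutativeSemigroup using (interchange)
open import Data.Product using (_×_; _,_; proj₁; proj₂; ∃-syntax)
open import Data.Rational using (ℚ; 0ℚ; 1ℚ) renaming (_+_ to _+ℚ_; _*_ to _*ℚ_)
import Data.Rational.Properties as ℚ
open import Function using (_∘_)
open import Function.Bundles using (Equivalence)
open import Relation.Binary.PropositionalEquality

-- Case analyses on ℚ-valued terms go through the when-lemmas below, whose ℚ arguments are variables:
-- a rewrite or with-abstraction inside a goal mentioning coeff (S α) makes Agda normalise rational
-- constants (gcd computations included), which is prohibitively expensive.

∑ : {A : Set} → (A → ℚ) → List A → ℚ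
∑ f = foldr (λ x q → f x +ℚ q) 0ℚ

when : Bool → ℚ → ℚ
when b q = if b then q else 0ℚ

when-0 : ∀ b → when b 0ℚ ≡ 0ℚ
when-0 true = refl
when-0 false = refl

when-cong : ∀ b {x y} → (b ≡ true → x ≡ y) → when b x ≡ when b y
when-cong true x≡y = x≡y refl
when-cong false _ = refl

when-intro : ∀ b {x y} → (b ≡ true → x ≡ y) → (b ≡ false → x ≡ 0ℚ) → x ≡ when b y
when-intro true x≡y _ = x≡y refl
when-intro false _ x≡0 = x≡0 refl

when-∧-* : ∀ b₁ b₂ x y → when (b₁ ∧ b₂) (x *ℚ y) ≡ when b₁ x *ℚ when b₂ y
when-∧-* true true x y = refl
when-∧-* true false x y = sym (ℚ.*-zeroʳ x)
when-∧-* false b₂ x y = sym (ℚ.*-zeroˡ (when b₂ y))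

module _ {A : Set} where

  ∑-++ : (f : A → ℚ) (xs ys : List A) → ∑ f (xs ++ ys) ≡ ∑ f xs +ℚ ∑ f ys
  ∑-++ f [] ys = sym (ℚ.+-identityˡ _)
  ∑-++ f (x ∷ xs) ys = trans (cong (f x +ℚ_) (∑-++ f xs ys)) (sym (ℚ.+-assoc (f x) _ _))

  ∑-map : {B : Set} (f : B → ℚ) (g : A → B) (xs : List A) → ∑ f (map g xs) ≡ ∑ (f ∘ g) xs
  ∑-map f g [] = refl
  ∑-map f g (x ∷ xs) = cong (f (g x) +ℚ_) (∑-map f g xs)

  ∑-cong : {f g : A → ℚ} (xs : List A) → All (λ x → f x ≡ g x) xs → ∑ f xs ≡ ∑ g xs
  ∑-cong [] [] = refl
  ∑-cong (x ∷ xs) (fx≡gx ∷ f≡g) = cong₂ _+ℚ_ fx≡gx (∑-cong xs f≡g)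

  ∑-zero : {f : A → ℚ} (xs : List A) → (∀ x → f x ≡ 0ℚ) → ∑ f xs ≡ 0ℚ
  ∑-zero [] _ = refl
  ∑-zero (x ∷ xs) f≡0 = trans (cong₂ _+ℚ_ (f≡0 x) (∑-zero xs f≡0)) (ℚ.+-identityˡ 0ℚ)

  ∑-*ˡ : (q : ℚ) (f : A → ℚ) (xs : List A) → q *ℚ ∑ f xs ≡ ∑ (λ x → q *ℚ f x) xs
  ∑-*ˡ q f [] = ℚ.*-zeroʳ q
  ∑-*ˡ q f (x ∷ xs) = trans (ℚ.*-distribˡ-+ q (f x) _) (cong (q *ℚ f x +ℚ_) (∑-*ˡ q f xs))

  ∑-*ʳ : (q : ℚ) (f : A → ℚ) (xs : List A) → ∑ f xs *ℚ q ≡ ∑ (λ x → f x *ℚ q) xs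
  ∑-*ʳ q f [] = ℚ.*-zeroˡ q
  ∑-*ʳ q f (x ∷ xs) = trans (ℚ.*-distribʳ-+ q (f x) _) (cong (f x *ℚ q +ℚ_) (∑-*ʳ q f xs))

-- Coefficients of the coproduct and of tensor products

-- The summands of coeff and coeff₂: coeff F β is definitionally ∑ (coeffTerm β) F.
coeffTerm : Comp → ℚ × Comp → ℚ
coeffTerm β p = when (proj₂ p ≡ᶜ β) (proj₁ p)

coeffTerm₂ : Comp → Comp → ℚ × Comp × Comp → ℚ
coeffTerm₂ β γ p = when ((proj₁ (proj₂ p) ≡ᶜ β) ∧ (proj₂ (proj₂ p) ≡ᶜ γ)) (proj₁ p)

coeff₂-concatMap : {A : Set} (h : A → QSym⊗QSymElt) (xs : List A) (β γ : Comp) →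
  coeff₂ (concatMap h xs) β γ ≡ ∑ (λ x → coeff₂ (h x) β γ) xs
coeff₂-concatMap h [] β γ = refl
coeff₂-concatMap h (x ∷ xs) β γ =
  trans (∑-++ (coeffTerm₂ β γ) (h x) (concatMap h xs)) (cong (coeff₂ (h x) β γ +ℚ_) (coeff₂-concatMap h xs β γ))

coeff₂-⊗ : (F G : QSymElt) (β γ : Comp) → coeff₂ (F ⊗ G) β γ ≡ coeff F β *ℚ coeff G γ
coeff₂-⊗ F G β γ = begin
  coeff₂ (F ⊗ G) β γ
    ≡⟨ coeff₂-concatMap (λ p → map (λ q → (proj₁ p *ℚ proj₁ q) , proj₂ p , proj₂ q) G) F β γ ⟩
  ∑ (λ p → coeff₂ (map (λ q → (proj₁ p *ℚ proj₁ q) , proj₂ p , proj₂ q) G) β γ) F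
    ≡⟨ ∑-cong F (universal (λ p → trans (∑-map (coeffTerm₂ β γ) _ G) (row p)) F) ⟩
  ∑ (λ p → coeffTerm β p *ℚ coeff G γ) F
    ≡⟨ ∑-*ʳ (coeff G γ) (coeffTerm β) F ⟨
  coeff F β *ℚ coeff G γ ∎
  where
  open ≡-Reasoning
  row : (p : ℚ × Comp) →
    ∑ (λ q → when ((proj₂ p ≡ᶜ β) ∧ (proj₂ q ≡ᶜ γ)) (proj₁ p *ℚ proj₁ q)) G ≡ coeffTerm β p *ℚ coeff G γ
  row (c , δ) = trans (∑-cong G (universal (λ q → when-∧-* (δ ≡ᶜ β) (proj₂ q ≡ᶜ γ) c (proj₁ q)) G))
                      (sym (∑-*ˡ (when (δ ≡ᶜ β) c) (coeffTerm γ) G))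

deconcatTerm : Comp → Comp → ℚ → Comp × Comp → ℚ
deconcatTerm β γ q d = when ((proj₁ d ≡ᶜ β) ∧ (proj₂ d ≡ᶜ γ)) q

consFirst : ℕ → Comp × Comp → Comp × Comp
consFirst a d = (a ∷ proj₁ d) , proj₂ d

∑-deconcat : (δ β γ : Comp) (q : ℚ) → ∑ (deconcatTerm β γ q) (deconcat δ) ≡ when (δ ≡ᶜ (β ++ γ)) q
∑-deconcat [] [] γ q = ℚ.+-identityʳ _
∑-deconcat [] (b ∷ β) γ q = ℚ.+-identityʳ _
∑-deconcat (a ∷ δ) [] γ q =
  trans (cong (when ((a ∷ δ) ≡ᶜ γ) q +ℚ_)
              (trans (∑-map (deconcatTerm [] γ q) (consFirst a) (deconcat δ))
                     (∑-zero (deconcat δ) (λ _ → refl))))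
        (ℚ.+-identityʳ _)
∑-deconcat (a ∷ δ) (b ∷ β) γ q =
  trans (ℚ.+-identityˡ _) (trans (∑-map (deconcatTerm (b ∷ β) γ q) (consFirst a) (deconcat δ)) (rest (a ≡ᵇ b)))
  where
  rest : (t : Bool) → ∑ (λ d → when ((t ∧ (proj₁ d ≡ᶜ β)) ∧ (proj₂ d ≡ᶜ γ)) q) (deconcat δ)
                      ≡ when (t ∧ (δ ≡ᶜ (β ++ γ))) q
  rest true = ∑-deconcat δ β γ q
  rest false = ∑-zero (deconcat δ) (λ _ → refl)

coeff₂-Δ : (F : QSymElt) (β γ : Comp) → coeff₂ (Δ F) β γ ≡ coeff F (β ++ γ)
coeff₂-Δ F β γ = trans (coeff₂-concatMap Δterm F β γ) (∑-cong F (universal coeff₂-Δterm F))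
  where
  Δterm : ℚ × Comp → QSym⊗QSymElt
  Δterm p = map (λ d → proj₁ p , proj₁ d , proj₂ d) (deconcat (proj₂ p))
  coeff₂-Δterm : ∀ p → coeff₂ (Δterm p) β γ ≡ coeffTerm (β ++ γ) p
  coeff₂-Δterm (c , δ) =
    trans (∑-map (coeffTerm₂ β γ) (λ d → c , proj₁ d , proj₂ d) (deconcat δ)) (∑-deconcat δ β γ c)

∧-true⁻ : ∀ {x y} → x ∧ y ≡ true → x ≡ true × y ≡ true
∧-true⁻ {true} {true} _ = refl , refl

∧-true⁺ : ∀ {x y} → x ≡ true → y ≡ true → x ∧ y ≡ true
∧-true⁺ refl refl = refl

true⇔true⇒≡ : ∀ {x y} → (x ≡ true → y ≡ true) → (y ≡ true → x ≡ true) → x ≡ y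
true⇔true⇒≡ {true} x⇒y _ = sym (x⇒y refl)
true⇔true⇒≡ {false} {true} _ y⇒x = y⇒x refl
true⇔true⇒≡ {false} {false} _ _ = refl

≡ᵇ-true⇒≡ : ∀ m n → (m ≡ᵇ n) ≡ true → m ≡ n
≡ᵇ-true⇒≡ m n e = ≡ᵇ⇒≡ m n (Equivalence.from T-≡ e)

≡⇒≡ᵇ-true : ∀ m n → m ≡ n → (m ≡ᵇ n) ≡ true
≡⇒≡ᵇ-true m n e = Equivalence.to T-≡ (≡⇒≡ᵇ m n e)

≤⇒≤ᵇ-true : ∀ {m n} → m ≤ n → (m ≤ᵇ n) ≡ true
≤⇒≤ᵇ-true m≤n = Equivalence.to T-≡ (≤⇒≤ᵇ m≤n)

>⇒≤ᵇ-false : ∀ m n → n < m → (m ≤ᵇ n) ≡ false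
>⇒≤ᵇ-false m n n<m = ¬-not (<⇒≱ n<m ∘ ≤ᵇ⇒≤ m n ∘ Equivalence.from T-≡)

≡ᶜ⇒≡ : ∀ x y → (x ≡ᶜ y) ≡ true → x ≡ y
≡ᶜ⇒≡ [] [] _ = refl
≡ᶜ⇒≡ (a ∷ x) (b ∷ y) e with a ≡ᵇ b in a≡ᵇb
... | true = cong₂ _∷_ (≡ᵇ-true⇒≡ a b a≡ᵇb) (≡ᶜ⇒≡ x y e)

memᵇ⇒∈ : ∀ x L → memᵇ x L ≡ true → x ∈ L
memᵇ⇒∈ x (y ∷ L) e with x ≡ᵇ y in x≡ᵇy
... | true = here (≡ᵇ-true⇒≡ x y x≡ᵇy)
... | false = there (memᵇ⇒∈ x L e)

∈⇒memᵇ : ∀ x L → x ∈ L → memᵇ x L ≡ true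
∈⇒memᵇ x (y ∷ L) (here refl) rewrite ≡⇒≡ᵇ-true x x refl = refl
∈⇒memᵇ x (y ∷ L) (there x∈L) with x ≡ᵇ y
... | true = refl
... | false = ∈⇒memᵇ x L x∈L

allᵇ-memᵇ⇒⊆ : ∀ X Y → allᵇ (λ x → memᵇ x Y) X ≡ true → X ⊆ Y
allᵇ-memᵇ⇒⊆ (x ∷ X) Y e (here refl) = memᵇ⇒∈ x Y (proj₁ (∧-true⁻ e))
allᵇ-memᵇ⇒⊆ (x ∷ X) Y e (there z∈X) = allᵇ-memᵇ⇒⊆ X Y (proj₂ (∧-true⁻ {memᵇ x Y} e)) z∈X

⊆⇒allᵇ-memᵇ : ∀ X Y → X ⊆ Y → allᵇ (λ x → memᵇ x Y) X ≡ true
⊆⇒allᵇ-memᵇ [] Y _ = refl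
⊆⇒allᵇ-memᵇ (x ∷ X) Y X⊆Y = ∧-true⁺ (∈⇒memᵇ x Y (X⊆Y (here refl))) (⊆⇒allᵇ-memᵇ X Y (X⊆Y ∘ there))

≤ᶜ⇒ : ∀ β α → (β ≤ᶜ α) ≡ true → sum β ≡ sum α × descentSet β ⊆ descentSet α
≤ᶜ⇒ β α e = ≡ᵇ-true⇒≡ _ _ (proj₁ (∧-true⁻ e)) , allᵇ-memᵇ⇒⊆ _ _ (proj₂ (∧-true⁻ {sum β ≡ᵇ sum α} e))

⇒≤ᶜ : ∀ β α → sum β ≡ sum α → descentSet β ⊆ descentSet α → (β ≤ᶜ α) ≡ true
⇒≤ᶜ β α sum≡ D⊆D = ∧-true⁺ (≡⇒≡ᵇ-true _ _ sum≡) (⊆⇒allᵇ-memᵇ _ _ D⊆D)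

Positive : List ℕ → Set
Positive = All (0 <_)

positiveᵇ : Comp → Bool
positiveᵇ [] = true
positiveᵇ (zero ∷ δ) = false
positiveᵇ (suc _ ∷ δ) = positiveᵇ δ

positiveᵇ⇒ : ∀ δ → positiveᵇ δ ≡ true → Positive δ
positiveᵇ⇒ [] _ = []
positiveᵇ⇒ (suc x ∷ δ) e = s≤s z≤n ∷ positiveᵇ⇒ δ e

⇒positiveᵇ : ∀ δ → Positive δ → positiveᵇ δ ≡ true
⇒positiveᵇ [] _ = refl
⇒positiveᵇ (suc x ∷ δ) (_ ∷ pδ) = ⇒positiveᵇ δ pδ

indicator : Bool → ℕ
indicator true = 1
indicator false = 0

multiplicity : Comp → List Comp → ℕ
multiplicity δ [] = 0
multiplicity δ (x ∷ xs) = indicator (x ≡ᶜ δ) + multiplicity δ xs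

multiplicity-map : (f : Comp → Comp) {δ δ′ : Comp} → (∀ c → (f c ≡ᶜ δ) ≡ (c ≡ᶜ δ′)) →
  (L : List Comp) → multiplicity δ (map f L) ≡ multiplicity δ′ L
multiplicity-map f f≡ [] = refl
multiplicity-map f f≡ (c ∷ L) = cong₂ _+_ (cong indicator (f≡ c)) (multiplicity-map f f≡ L)

multiplicity-map-absent : (f : Comp → Comp) (δ : Comp) → (∀ c → (f c ≡ᶜ δ) ≡ false) →
  (L : List Comp) → multiplicity δ (map f L) ≡ 0
multiplicity-map-absent f δ f≢ [] = refl
multiplicity-map-absent f δ f≢ (c ∷ L) = cong₂ _+_ (cong indicator (f≢ c)) (multiplicity-map-absent f δ f≢ L)

-- comps (2 + n) = concatMap extend (comps (1 + n)).
extend : Comp → List Comp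
extend c = (1 ∷ c) ∷ incFirst c ∷ []

multiplicity-extend : ∀ δ L →
  multiplicity δ (concatMap extend L) ≡ multiplicity δ (map (1 ∷_) L) + multiplicity δ (map incFirst L)
multiplicity-extend δ [] = refl
multiplicity-extend δ (c ∷ L) = trans (cong (λ m → i + (j + m)) (multiplicity-extend δ L))
                                      (trans (sym (+-assoc i j _)) (interchange i j _ _))
  where
  i = indicator ((1 ∷ c) ≡ᶜ δ)
  j = indicator (incFirst c ≡ᶜ δ)

incFirst≡ᶜ[] : ∀ c → (incFirst c ≡ᶜ []) ≡ (c ≡ᶜ [])
incFirst≡ᶜ[] [] = refl
incFirst≡ᶜ[] (x ∷ c) = refl

incFirst≢ᶜ0∷ : ∀ δ c → (incFirst c ≡ᶜ (0 ∷ δ)) ≡ false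
incFirst≢ᶜ0∷ δ [] = refl
incFirst≢ᶜ0∷ δ (x ∷ c) = refl

incFirst≡ᶜsuc∷ : ∀ z δ c → (incFirst c ≡ᶜ (suc z ∷ δ)) ≡ (c ≡ᶜ (z ∷ δ))
incFirst≡ᶜsuc∷ z δ [] = refl
incFirst≡ᶜsuc∷ z δ (x ∷ c) = refl

isCompᵇ : ℕ → Comp → Bool
isCompᵇ n δ = (sum δ ≡ᵇ n) ∧ positiveᵇ δ

multiplicity-extend-comps : ∀ n L → (∀ δ → multiplicity δ L ≡ indicator (isCompᵇ (suc n) δ)) →
  ∀ δ → multiplicity δ (map (1 ∷_) L) + multiplicity δ (map incFirst L) ≡ indicator (isCompᵇ (suc (suc n)) δ)
multiplicity-extend-comps n L ih [] =
  cong₂ _+_ (multiplicity-map-absent (1 ∷_) [] (λ _ → refl) L)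
            (trans (multiplicity-map incFirst incFirst≡ᶜ[] L) (ih []))
multiplicity-extend-comps n L ih (zero ∷ δ) =
  trans (cong₂ _+_ (multiplicity-map-absent (1 ∷_) (0 ∷ δ) (λ _ → refl) L)
                   (multiplicity-map-absent incFirst (0 ∷ δ) (incFirst≢ᶜ0∷ δ) L))
        (cong indicator (sym (∧-zeroʳ (sum δ ≡ᵇ suc (suc n)))))
multiplicity-extend-comps n L ih (suc zero ∷ δ) =
  trans (cong₂ _+_ (trans (multiplicity-map (1 ∷_) (λ _ → refl) L) (ih δ))
                   (trans (multiplicity-map incFirst (incFirst≡ᶜsuc∷ 0 δ) L) (ih (0 ∷ δ))))
        (trans (cong (λ b → indicator (isCompᵇ (suc n) δ) + indicator b) (∧-zeroʳ (sum δ ≡ᵇ suc n)))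
               (+-identityʳ _))
multiplicity-extend-comps n L ih (suc (suc w) ∷ δ) =
  cong₂ _+_ (multiplicity-map-absent (1 ∷_) (suc (suc w) ∷ δ) (λ _ → refl) L)
            (trans (multiplicity-map incFirst (incFirst≡ᶜsuc∷ (suc w) δ) L) (ih (suc w ∷ δ)))

multiplicity-comps : ∀ n δ → multiplicity δ (comps n) ≡ indicator (isCompᵇ n δ)
multiplicity-comps zero [] = refl
multiplicity-comps zero (zero ∷ δ) = cong indicator (sym (∧-zeroʳ (sum δ ≡ᵇ 0)))
multiplicity-comps zero (suc x ∷ δ) = refl
multiplicity-comps (suc zero) [] = refl
multiplicity-comps (suc zero) (zero ∷ δ) = cong indicator (sym (∧-zeroʳ (sum δ ≡ᵇ 1)))
multiplicity-comps (suc zero) (suc zero ∷ []) = refl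
multiplicity-comps (suc zero) (suc zero ∷ zero ∷ δ) = cong indicator (sym (∧-zeroʳ (sum δ ≡ᵇ 0)))
multiplicity-comps (suc zero) (suc zero ∷ suc x ∷ δ) = refl
multiplicity-comps (suc zero) (suc (suc x) ∷ δ) = refl
multiplicity-comps (suc (suc n)) δ =
  trans (multiplicity-extend δ (comps (suc n)))
        (multiplicity-extend-comps n (comps (suc n)) (multiplicity-comps (suc n)) δ)

_×ℚ_ : ℕ → ℚ → ℚ
zero ×ℚ q = 0ℚ
suc k ×ℚ q = q +ℚ (k ×ℚ q)

coeff-filter : (f : Comp → ℚ) (p : Comp → Bool) (L : List Comp) (δ : Comp) →
  coeff (map (λ β → f β , β) (filterᵇ p L)) δ ≡ when (p δ) (multiplicity δ L ×ℚ f δ)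
coeff-filter f p [] δ = sym (when-0 (p δ))
coeff-filter f p (x ∷ L) δ with p x in px
... | true with x ≡ᶜ δ in x≡ᶜδ
...   | false = trans (ℚ.+-identityˡ _) (coeff-filter f p L δ)
...   | true with refl ← ≡ᶜ⇒≡ x δ x≡ᶜδ rewrite px =
  cong (f x +ℚ_) (trans (coeff-filter f p L x) (cong (λ b → when b _) px))
coeff-filter f p (x ∷ L) δ | false with x ≡ᶜ δ in x≡ᶜδ
...   | false = coeff-filter f p L δ
...   | true with refl ← ≡ᶜ⇒≡ x δ x≡ᶜδ rewrite px = trans (coeff-filter f p L x) (cong (λ b → when b _) px)

inSupportᵇ : Comp → Comp → Bool
inSupportᵇ α δ = ((mo α ≤ᶜ δ) ∧ (δ ≤ᶜ α)) ∧ isCompᵇ (sum α) δ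

coeff-S : ∀ α δ → coeff (S α) δ ≡ when (inSupportᵇ α δ) (coeffC α δ)
coeff-S α δ =
  trans (coeff-filter (coeffC α) (λ β → (mo α ≤ᶜ β) ∧ (β ≤ᶜ α)) (comps (sum α)) δ)
  (trans (cong (λ m → when ((mo α ≤ᶜ δ) ∧ (δ ≤ᶜ α)) (m ×ℚ coeffC α δ)) (multiplicity-comps (sum α) δ))
         (once ((mo α ≤ᶜ δ) ∧ (δ ≤ᶜ α)) (isCompᵇ (sum α) δ)))
  where
  once : ∀ b₁ b₂ → when b₁ (indicator b₂ ×ℚ coeffC α δ) ≡ when (b₁ ∧ b₂) (coeffC α δ)
  once true true = ℚ.+-identityʳ _
  once true false = refl
  once false b₂ = refl

-- Coarsenings of a composition

-- A cut list records, for each gap between consecutive parts, whether to cut there;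
-- gaps beyond the end of the list are cut.
Cuts : Set
Cuts = List Bool

firstCut : Cuts → Bool
firstCut [] = true
firstCut (t ∷ _) = t

laterCuts : Cuts → Cuts
laterCuts [] = []
laterCuts (_ ∷ c) = c

mergeStep : ℕ → Bool → Comp → Comp
mergeStep a t [] = a ∷ []
mergeStep a t (x ∷ xs) = if t then a ∷ x ∷ xs else (a + x) ∷ xs

-- The coarsening of a ∷ as which keeps exactly the cuts selected by c.
merge : ℕ → List ℕ → Cuts → Comp
merge a [] c = a ∷ []
merge a (b ∷ r) c = mergeStep a (firstCut c) (merge b r (laterCuts c))

merge-nonempty : ∀ a as c → ∃[ y ] ∃[ ys ] merge a as c ≡ y ∷ ys
merge-nonempty a [] c = a , [] , refl
merge-nonempty a (b ∷ r) c with merge b r (laterCuts c) | merge-nonempty b r (laterCuts c)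
... | .(y ∷ ys) | y , ys , refl with firstCut c
...   | true = a , y ∷ ys , refl
...   | false = a + y , ys , refl

merge-positive : ∀ {a} as c → 0 < a → Positive as → Positive (merge a as c)
merge-positive [] c 0<a _ = 0<a ∷ []
merge-positive {a} (b ∷ r) c 0<a (0<b ∷ pr) with merge b r (laterCuts c) | merge-positive r (laterCuts c) 0<b pr
... | [] | _ = 0<a ∷ []
... | x ∷ xs | 0<x ∷ pxs with firstCut c
...   | true = 0<a ∷ 0<x ∷ pxs
...   | false = ≤-trans 0<x (m≤n+m x a) ∷ pxs

merge-sum : ∀ a as c → sum (merge a as c) ≡ a + sum as
merge-sum a [] c = refl
merge-sum a (b ∷ r) c
  with merge b r (laterCuts c) | merge-nonempty b r (laterCuts c) | merge-sum b r (laterCuts c)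
... | .(y ∷ ys) | y , ys , refl | sum≡ with firstCut c
...   | true = cong (a +_) sum≡
...   | false = trans (+-assoc a y (sum ys)) (cong (a +_) sum≡)

merge-allCuts : ∀ a as → merge a as [] ≡ a ∷ as
merge-allCuts a [] = refl
merge-allCuts a (b ∷ r) rewrite merge-allCuts b r = refl

merge-noCuts : ∀ a as → merge a as (replicate (length as) false) ≡ (a + sum as) ∷ []
merge-noCuts a [] = cong (_∷ []) (sym (+-identityʳ a))
merge-noCuts a (b ∷ r) rewrite merge-noCuts b r = refl

oddToEvenCuts : ℕ → List ℕ → Cuts
oddToEvenCuts a [] = []
oddToEvenCuts a (b ∷ r) = (isOdd a ∧ isEven b) ∷ oddToEvenCuts b r

mo≡merge : ∀ a as → mo (a ∷ as) ≡ merge a as (oddToEvenCuts a as)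
mo≡merge a [] = refl
mo≡merge a (b ∷ r) = trans mo-step (cong (mergeStep a (isOdd a ∧ isEven b)) (mo≡merge b r))
  where
  mo-step : mo (a ∷ b ∷ r) ≡ mergeStep a (isOdd a ∧ isEven b) (mo (b ∷ r))
  mo-step with mo (b ∷ r)
  ... | [] = refl
  ... | x ∷ xs = refl

shifted : ℕ → Bool → List ℕ → List ℕ
shifted a t X = if t then a ∷ map (a +_) X else map (a +_) X

descentSet-+head : ∀ a x xs → descentSet ((a + x) ∷ xs) ≡ map (a +_) (descentSet (x ∷ xs))
descentSet-+head a x [] = refl
descentSet-+head a x (y ∷ ys) =
  cong ((a + x) ∷_) (trans (map-cong (+-assoc a x) (descentSet (y ∷ ys))) (map-∘ (descentSet (y ∷ ys))))

descentSet-mergeStep : ∀ a t x xs → descentSet (mergeStep a t (x ∷ xs)) ≡ shifted a t (descentSet (x ∷ xs))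
descentSet-mergeStep a true x xs = refl
descentSet-mergeStep a false x xs = descentSet-+head a x xs

descentSet-merge : ∀ a b r c →
  descentSet (merge a (b ∷ r) c) ≡ shifted a (firstCut c) (descentSet (merge b r (laterCuts c)))
descentSet-merge a b r c with merge b r (laterCuts c) | merge-nonempty b r (laterCuts c)
... | .(y ∷ ys) | y , ys , refl = descentSet-mergeStep a (firstCut c) y ys

descentSet-positive : ∀ δ → Positive δ → Positive (descentSet δ)
descentSet-positive [] _ = []
descentSet-positive (a ∷ []) _ = []
descentSet-positive (a ∷ b ∷ r) (0<a ∷ pr) =
  0<a ∷ All.map⁺ (All.map (λ {y} 0<y → ≤-trans 0<y (m≤n+m y a)) (descentSet-positive (b ∷ r) pr))

∈-shifted⁺ : ∀ {a t x X} → x ∈ X → a + x ∈ shifted a t X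
∈-shifted⁺ {a} {true} x∈X = there (∈-map⁺ (a +_) x∈X)
∈-shifted⁺ {a} {false} x∈X = ∈-map⁺ (a +_) x∈X

∈-shifted⁻ : ∀ {a t x X} → 0 < x → a + x ∈ shifted a t X → x ∈ X
∈-shifted⁻ {a} {true} 0<x (here a+x≡a) = ⊥-elim (<⇒≢ (m<m+n a 0<x) (sym a+x≡a))
∈-shifted⁻ {a} {true} 0<x (there a+x∈) = ∈-shifted⁻ {a} {false} 0<x a+x∈
∈-shifted⁻ {a} {false} 0<x a+x∈ with ∈-map⁻ (a +_) a+x∈
... | y , y∈X , a+x≡a+y rewrite +-cancelˡ-≡ a _ _ a+x≡a+y = y∈X

shifted-⊆⁺ : ∀ a {t u X Y} → (not t ∨ u) ≡ true → X ⊆ Y → shifted a t X ⊆ shifted a u Y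
shifted-⊆⁺ a {true} {true} _ X⊆Y (here refl) = here refl
shifted-⊆⁺ a {true} {true} _ X⊆Y (there z∈) with ∈-map⁻ (a +_) z∈
... | x , x∈X , refl = ∈-shifted⁺ (X⊆Y x∈X)
shifted-⊆⁺ a {false} _ X⊆Y z∈ with ∈-map⁻ (a +_) z∈
... | x , x∈X , refl = ∈-shifted⁺ (X⊆Y x∈X)

shifted-⊆⁻ : ∀ a {t u X Y} → Positive X → Positive Y → shifted a t X ⊆ shifted a u Y →
  ((not t ∨ u) ≡ true) × X ⊆ Y
shifted-⊆⁻ a {t} {u} pX pY sX⊆sY =
  cut⇒cut t u sX⊆sY , λ x∈X → ∈-shifted⁻ (All.lookup pX x∈X) (sX⊆sY (∈-shifted⁺ x∈X))
  where
  cut⇒cut : ∀ t u → shifted a t _ ⊆ shifted a u _ → (not t ∨ u) ≡ true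
  cut⇒cut false u _ = refl
  cut⇒cut true true _ = refl
  cut⇒cut true false sX⊆sY with ∈-map⁻ (a +_) (sX⊆sY (here refl))
  ... | y , y∈Y , a≡a+y = ⊥-elim (<⇒≢ (m<m+n a (All.lookup pY y∈Y)) a≡a+y)

subCuts : List ℕ → Cuts → Cuts → Bool
subCuts [] d c = true
subCuts (_ ∷ r) d c = (not (firstCut d) ∨ firstCut c) ∧ subCuts r (laterCuts d) (laterCuts c)

subCuts⇒⊆ : ∀ a as d c → subCuts as d c ≡ true → descentSet (merge a as d) ⊆ descentSet (merge a as c)
subCuts⇒⊆ a [] d c _ ()
subCuts⇒⊆ a (b ∷ r) d c d⊑c rewrite descentSet-merge a b r d | descentSet-merge a b r c =
  shifted-⊆⁺ a (proj₁ (∧-true⁻ d⊑c)) (subCuts⇒⊆ b r (laterCuts d) (laterCuts c) (proj₂ (∧-true⁻ d⊑c)))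

⊆⇒subCuts : ∀ {a} as d c → Positive as →
  descentSet (merge a as d) ⊆ descentSet (merge a as c) → subCuts as d c ≡ true
⊆⇒subCuts [] d c _ _ = refl
⊆⇒subCuts {a} (b ∷ r) d c (0<b ∷ pr) D⊆D
  rewrite descentSet-merge a b r d | descentSet-merge a b r c
  with shifted-⊆⁻ a (descentSet-positive _ (merge-positive r (laterCuts d) 0<b pr))
                    (descentSet-positive _ (merge-positive r (laterCuts c) 0<b pr)) D⊆D
... | t⇒u , D′⊆D′ = ∧-true⁺ t⇒u (⊆⇒subCuts r (laterCuts d) (laterCuts c) pr D′⊆D′)

subCuts-allCuts : ∀ as d → subCuts as d [] ≡ true
subCuts-allCuts [] d = refl
subCuts-allCuts (_ ∷ r) d rewrite ∨-zeroʳ (not (firstCut d)) = subCuts-allCuts r (laterCuts d)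

-- The first part x of δ is either a, and δ cuts after a, or a + z for a descent z of b ∷ r,
-- and δ merges a into the following part.
coarsening⇒merge : ∀ {a} as δ → 0 < a → Positive as → Positive δ → sum δ ≡ a + sum as →
  descentSet δ ⊆ descentSet (a ∷ as) → ∃[ c ] δ ≡ merge a as c
coarsening⇒merge {a} [] [] 0<a _ _ 0≡a+0 _ = ⊥-elim (<⇒≢ 0<a (trans 0≡a+0 (+-identityʳ a)))
coarsening⇒merge {a} [] (x ∷ []) _ _ _ x+0≡a+0 _ = [] , cong (_∷ []) (+-cancelʳ-≡ 0 x a x+0≡a+0)
coarsening⇒merge [] (x ∷ y ∷ δ) _ _ _ _ D⊆D with () ← D⊆D (here refl)
coarsening⇒merge {a} (b ∷ r) [] 0<a _ _ 0≡a+s _ = ⊥-elim (<⇒≢ (≤-trans 0<a (m≤m+n a _)) 0≡a+s)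
coarsening⇒merge {a} (b ∷ r) (x ∷ []) _ _ _ x+0≡ _ =
  replicate (length (b ∷ r)) false ,
  trans (cong (_∷ []) (trans (sym (+-identityʳ x)) x+0≡)) (sym (merge-noCuts a (b ∷ r)))
coarsening⇒merge {a} (b ∷ r) (x ∷ y ∷ δ) 0<a (0<b ∷ pr) (_ ∷ pδ) sum≡ D⊆D
  with descentSet-positive (b ∷ r) (0<b ∷ pr) | D⊆D (here refl)
... | pD | here refl
  with c , eq ← coarsening⇒merge r (y ∷ δ) 0<b pr pδ (+-cancelˡ-≡ a _ _ sum≡)
                  (proj₂ (shifted-⊆⁻ a {true} {true} (descentSet-positive _ pδ) pD D⊆D))
  = true ∷ c , cong (mergeStep a true) eq
... | pD | there x∈ with ∈-map⁻ (a +_) x∈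
...   | z , z∈D , refl with 0<z ← All.lookup pD z∈D
  with c , eq ← coarsening⇒merge r (z ∷ y ∷ δ) 0<b pr (0<z ∷ pδ)
                  (+-cancelˡ-≡ a _ _ (trans (sym (+-assoc a z _)) sum≡))
                  (proj₂ (shifted-⊆⁻ a {false} {true} (descentSet-positive _ (0<z ∷ pδ)) pD
                           (subst (_⊆ descentSet (a ∷ b ∷ r)) (descentSet-+head a z (y ∷ δ)) D⊆D)))
  = false ∷ c , cong (mergeStep a false) eq

-- The support of a shuffle function

sum≡0⇒[] : ∀ δ → Positive δ → sum δ ≡ 0 → δ ≡ []
sum≡0⇒[] [] _ _ = refl
sum≡0⇒[] (suc x ∷ δ) _ ()
sum≡0⇒[] (zero ∷ δ) (() ∷ _) _

-- δ lies in the support of S α, i.e. m_o(α) ≤ δ ≤ α: δ is a coarsening of α keeping its odd-to-even cuts.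
Support : Comp → Comp → Set
Support [] δ = δ ≡ []
Support (a ∷ as) δ = ∃[ c ] subCuts as (oddToEvenCuts a as) c ≡ true × δ ≡ merge a as c

support-sum : ∀ α δ → Support α δ → sum δ ≡ sum α
support-sum [] .[] refl = refl
support-sum (a ∷ as) .(merge a as c) (c , _ , refl) = merge-sum a as c

support-positive : ∀ α δ → Positive α → Support α δ → Positive δ
support-positive [] .[] _ refl = []
support-positive (a ∷ as) .(merge a as c) (0<a ∷ pas) (c , _ , refl) = merge-positive as c 0<a pas

support⇒inSupportᵇ : ∀ α δ → Positive α → Support α δ → inSupportᵇ α δ ≡ true
support⇒inSupportᵇ [] .[] _ refl = refl
support⇒inSupportᵇ (a ∷ as) .(merge a as c) (0<a ∷ pas) (c , ote⊑c , refl) =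
  ∧-true⁺ (∧-true⁺ mo≤δ δ≤α)
          (∧-true⁺ (≡⇒≡ᵇ-true _ _ (merge-sum a as c)) (⇒positiveᵇ _ (merge-positive as c 0<a pas)))
  where
  mo≤δ : (mo (a ∷ as) ≤ᶜ merge a as c) ≡ true
  mo≤δ rewrite mo≡merge a as =
    ⇒≤ᶜ _ _ (trans (merge-sum a as _) (sym (merge-sum a as c))) (subCuts⇒⊆ a as _ c ote⊑c)
  δ≤α : (merge a as c ≤ᶜ (a ∷ as)) ≡ true
  δ≤α = ⇒≤ᶜ _ _ (merge-sum a as c)
          (subst (λ α′ → descentSet (merge a as c) ⊆ descentSet α′) (merge-allCuts a as)
                 (subCuts⇒⊆ a as c [] (subCuts-allCuts as c)))

coarsening⇒support : ∀ α δ → Positive α → Positive δ → sum δ ≡ sum α → descentSet δ ⊆ descentSet α →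
  descentSet (mo α) ⊆ descentSet δ → Support α δ
coarsening⇒support [] δ _ pδ sum≡ _ _ = sum≡0⇒[] δ pδ sum≡
coarsening⇒support (a ∷ as) δ (0<a ∷ pas) pδ sum≡ D⊆D Dmo⊆D
  with c , refl ← coarsening⇒merge as δ 0<a pas pδ sum≡ D⊆D =
  c , ⊆⇒subCuts as _ c pas (subst (λ μ → descentSet μ ⊆ descentSet (merge a as c)) (mo≡merge a as) Dmo⊆D) , refl

inSupportᵇ⇒support : ∀ α δ → Positive α → inSupportᵇ α δ ≡ true → Support α δ
inSupportᵇ⇒support α δ pα e
  with bounds , isComp ← ∧-true⁻ {(mo α ≤ᶜ δ) ∧ (δ ≤ᶜ α)} e
  with mo≤δ , δ≤α ← ∧-true⁻ {mo α ≤ᶜ δ} bounds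
  with sum≡ , D⊆D ← ≤ᶜ⇒ δ α δ≤α =
  coarsening⇒support α δ pα (positiveᵇ⇒ δ (proj₂ (∧-true⁻ {sum δ ≡ᵇ sum α} isComp))) sum≡ D⊆D
                     (proj₂ (≤ᶜ⇒ (mo α) δ mo≤δ))

-- firstCut (dropCuts (length as) c) is the cut of merge a (as ++ bs) c right after as.
dropCuts : ℕ → Cuts → Cuts
dropCuts zero c = c
dropCuts (suc n) c = dropCuts n (laterCuts c)

-- c cut down, or padded with its default cuts, to one entry per gap of a ∷ as, so that further cuts
-- can be appended.
padCuts : List ℕ → Cuts → Cuts
padCuts [] c = []
padCuts (_ ∷ r) c = firstCut c ∷ padCuts r (laterCuts c)

lastPart : ℕ → List ℕ → ℕ
lastPart a [] = a
lastPart a (x ∷ r) = lastPart x r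

mergeStep-++ : ∀ a t x P Q → mergeStep a t ((x ∷ P) ++ Q) ≡ mergeStep a t (x ∷ P) ++ Q
mergeStep-++ a true x P Q = refl
mergeStep-++ a false x P Q = refl

merge-++ : ∀ a as b s c → firstCut (dropCuts (length as) c) ≡ true →
  merge a (as ++ b ∷ s) c ≡ merge a as c ++ merge b s (laterCuts (dropCuts (length as) c))
merge-++ a [] b s c cut with merge b s (laterCuts c) | merge-nonempty b s (laterCuts c)
... | .(y ∷ ys) | y , ys , refl rewrite cut = refl
merge-++ a (x ∷ r) b s c cut rewrite merge-++ x r b s (laterCuts c) cut
  with merge x r (laterCuts c) | merge-nonempty x r (laterCuts c)
... | .(y ∷ ys) | y , ys , refl = mergeStep-++ a (firstCut c) y ys _

merge-padCuts : ∀ a as c e → merge a as (padCuts as c ++ e) ≡ merge a as c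
merge-padCuts a [] c e = refl
merge-padCuts a (b ∷ r) c e rewrite merge-padCuts b r (laterCuts c) e = refl

dropCuts-padCuts : ∀ as c e → dropCuts (length as) (padCuts as c ++ e) ≡ e
dropCuts-padCuts [] c e = refl
dropCuts-padCuts (_ ∷ r) c e = dropCuts-padCuts r (laterCuts c) e

subCuts-padCuts : ∀ as d c e → subCuts as d (padCuts as c ++ e) ≡ subCuts as d c
subCuts-padCuts [] d c e = refl
subCuts-padCuts (_ ∷ r) d c e rewrite subCuts-padCuts r (laterCuts d) (laterCuts c) e = refl

-- The only odd-to-even cut of (a ∷ as) ++ (b ∷ s) not inside one of the two factors is the one between them.
subCuts-oddToEvenCuts-++ : ∀ a as b s c →
  subCuts (as ++ b ∷ s) (oddToEvenCuts a (as ++ b ∷ s)) c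
  ≡ subCuts as (oddToEvenCuts a as) c
    ∧ ((not (isOdd (lastPart a as) ∧ isEven b) ∨ firstCut (dropCuts (length as) c))
       ∧ subCuts s (oddToEvenCuts b s) (laterCuts (dropCuts (length as) c)))
subCuts-oddToEvenCuts-++ a [] b s c = refl
subCuts-oddToEvenCuts-++ a (x ∷ r) b s c rewrite subCuts-oddToEvenCuts-++ x r b s (laterCuts c) =
  sym (∧-assoc (not (isOdd a ∧ isEven x) ∨ firstCut c) _ _)

support-++ : ∀ α₁ α₂ β γ → Support α₁ β → Support α₂ γ → Support (α₁ ++ α₂) (β ++ γ)
support-++ [] α₂ .[] γ refl sγ = sγ
support-++ (a ∷ as) [] β .[] sβ refl rewrite ++-identityʳ as | ++-identityʳ β = sβ
support-++ (a ∷ as) (b ∷ s) .(merge a as c₁) .(merge b s c₂) (c₁ , ote⊑c₁ , refl) (c₂ , ote⊑c₂ , refl) =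
  c , ote⊑c , sym merge≡
  where
  c = padCuts as c₁ ++ true ∷ c₂
  merge≡ : merge a (as ++ b ∷ s) c ≡ merge a as c₁ ++ merge b s c₂
  merge≡ = trans (merge-++ a as b s c (cong firstCut (dropCuts-padCuts as c₁ (true ∷ c₂))))
                 (cong₂ _++_ (merge-padCuts a as c₁ _)
                             (cong (merge b s ∘ laterCuts) (dropCuts-padCuts as c₁ (true ∷ c₂))))
  ote⊑c : subCuts (as ++ b ∷ s) (oddToEvenCuts a (as ++ b ∷ s)) c ≡ true
  ote⊑c rewrite subCuts-oddToEvenCuts-++ a as b s c | dropCuts-padCuts as c₁ (true ∷ c₂)
              | subCuts-padCuts as (oddToEvenCuts a as) c₁ (true ∷ c₂) | ote⊑c₁ | ote⊑c₂
              | ∨-zeroʳ (not (isOdd (lastPart a as) ∧ isEven b)) = refl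

++-cancel-sum : ∀ xs xs′ ys ys′ → Positive xs → Positive xs′ →
  xs ++ ys ≡ xs′ ++ ys′ → sum xs ≡ sum xs′ → xs ≡ xs′ × ys ≡ ys′
++-cancel-sum [] [] ys ys′ _ _ eq _ = refl , eq
++-cancel-sum [] (x′ ∷ xs′) ys ys′ _ (0<x′ ∷ _) _ 0≡ = ⊥-elim (<⇒≢ (≤-trans 0<x′ (m≤m+n x′ _)) 0≡)
++-cancel-sum (x ∷ xs) [] ys ys′ (0<x ∷ _) _ _ sum≡0 = ⊥-elim (<⇒≢ (≤-trans 0<x (m≤m+n x _)) (sym sum≡0))
++-cancel-sum (x ∷ xs) (x′ ∷ xs′) ys ys′ (_ ∷ pxs) (_ ∷ pxs′) eq sum≡
  with refl , eq′ ← ∷-injective eq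
  with refl , refl ← ++-cancel-sum xs xs′ ys ys′ pxs pxs′ eq′ (+-cancelˡ-≡ x _ _ sum≡) = refl , refl

cut-at-prefix : ∀ a as b s c β γ → 0 < a → Positive as → 0 < b → Positive s →
  merge a (as ++ b ∷ s) c ≡ β ++ γ → sum β ≡ a + sum as → firstCut (dropCuts (length as) c) ≡ true
cut-at-prefix a as b s c [] γ 0<a _ _ _ _ 0≡ = ⊥-elim (<⇒≢ (≤-trans 0<a (m≤m+n a _)) 0≡)
cut-at-prefix a [] b s c (x ∷ β) γ _ _ 0<b ps merge≡ sum≡
  with merge b s (laterCuts c) | merge-nonempty b s (laterCuts c) | merge-positive s (laterCuts c) 0<b ps
... | .(y ∷ ys) | y , ys , refl | 0<y ∷ _ with firstCut c
...   | true = refl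
...   | false with refl ← proj₁ (∷-injective merge≡) =
  ⊥-elim (<⇒≢ 0<y (sym (m+n≡0⇒m≡0 y (+-cancelˡ-≡ a _ _ (trans (sym (+-assoc a y _)) sum≡)))))
cut-at-prefix a (x′ ∷ r) b s c (x ∷ β) γ _ (0<x′ ∷ pr) 0<b ps merge≡ sum≡
  with merge x′ (r ++ b ∷ s) (laterCuts c) | merge-nonempty x′ (r ++ b ∷ s) (laterCuts c)
     | cut-at-prefix x′ r b s (laterCuts c)
... | .(y ∷ ys) | y , ys , refl | ih with firstCut c
...   | true with refl , merge≡′ ← ∷-injective merge≡ =
  ih β γ 0<x′ pr 0<b ps merge≡′ (+-cancelˡ-≡ a _ _ sum≡)
...   | false with refl , merge≡′ ← ∷-injective merge≡ =
  ih (y ∷ β) γ 0<x′ pr 0<b ps (cong (y ∷_) merge≡′) (+-cancelˡ-≡ a _ _ (trans (sym (+-assoc a y _)) sum≡))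

sum-++-rest : ∀ β γ {n} → sum (β ++ γ) ≡ n → sum β ≡ n → sum γ ≡ 0
sum-++-rest β γ {n} sum-βγ sum-β = +-cancelˡ-≡ (sum β) _ _ (begin
  sum β + sum γ   ≡⟨ sum-++ β γ ⟨
  sum (β ++ γ)    ≡⟨ trans sum-βγ (sym sum-β) ⟩
  sum β           ≡⟨ +-identityʳ (sum β) ⟨
  sum β + 0       ∎)
  where open ≡-Reasoning

support-split : ∀ α₁ α₂ β γ → Positive α₁ → Positive α₂ →
  Support (α₁ ++ α₂) (β ++ γ) → sum β ≡ sum α₁ → Support α₁ β × Support α₂ γ
support-split [] α₂ β γ _ pα₂ sβγ sum≡
  with refl ← sum≡0⇒[] β (All.++⁻ˡ β (support-positive α₂ (β ++ γ) pα₂ sβγ)) sum≡ = refl , sβγ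
support-split (a ∷ as) [] β γ pα₁ _ sβγ sum≡ rewrite ++-identityʳ as
  with refl ← sum≡0⇒[] γ (All.++⁻ʳ β (support-positive (a ∷ as) (β ++ γ) pα₁ sβγ))
                         (sum-++-rest β γ (support-sum (a ∷ as) (β ++ γ) sβγ) sum≡)
  rewrite ++-identityʳ β = sβγ , refl
support-split (a ∷ as) (b ∷ s) β γ (0<a ∷ pas) (0<b ∷ ps) (c , ote⊑c , βγ≡) sum≡ =
  (c , proj₁ ote⊑c-split , sym β≡) ,
  (laterCuts (dropCuts (length as) c) , proj₂ (∧-true⁻ (proj₂ ote⊑c-split)) , sym γ≡)
  where
  cut = cut-at-prefix a as b s c β γ 0<a pas 0<b ps (sym βγ≡) sum≡
  pβ = All.++⁻ˡ β (support-positive (a ∷ as ++ b ∷ s) (β ++ γ) (0<a ∷ All.++⁺ pas (0<b ∷ ps)) (c , ote⊑c , βγ≡))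
  β≡γ≡ = ++-cancel-sum (merge a as c) β _ γ (merge-positive as c 0<a pas) pβ
           (trans (sym (merge-++ a as b s c cut)) (sym βγ≡)) (trans (merge-sum a as c) (sym sum≡))
  β≡ = proj₁ β≡γ≡
  γ≡ = proj₂ β≡γ≡
  ote⊑c-split = ∧-true⁻ {subCuts as (oddToEvenCuts a as) c}
                  (trans (sym (subCuts-oddToEvenCuts-++ a as b s c)) ote⊑c)

-- Multiplicativity of the coefficients

takeBlock-∷ : ∀ t a r → takeBlock t (a ∷ r)
  ≡ (if t ≤ᵇ a then (a ∷ [] , r) else (a ∷ proj₁ (takeBlock (t ∸ a) r) , proj₂ (takeBlock (t ∸ a) r)))
takeBlock-∷ t a r with t ≤ᵇ a
... | true = refl
... | false with takeBlock (t ∸ a) r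
...   | _ , _ = refl

blocks-∷ : ∀ α b β → blocks α (b ∷ β) ≡ proj₁ (takeBlock b α) ∷ blocks (proj₂ (takeBlock b α)) β
blocks-∷ α b β with takeBlock b α
... | _ , _ = refl

takeBlock-sum : ∀ a g L → 0 < a → Positive g → takeBlock (sum (a ∷ g)) (a ∷ g ++ L) ≡ (a ∷ g , L)
takeBlock-sum a [] L _ _ rewrite takeBlock-∷ (a + 0) a L | +-identityʳ a | ≤⇒≤ᵇ-true (≤-refl {a}) = refl
takeBlock-sum a (x ∷ g) L _ (0<x ∷ pg)
  rewrite takeBlock-∷ (a + (x + sum g)) a (x ∷ g ++ L)
        | >⇒≤ᵇ-false (a + (x + sum g)) a (m<m+n a (<-≤-trans 0<x (m≤m+n x (sum g))))
        | m+n∸m≡n a (x + sum g) | takeBlock-sum x g L 0<x pg = refl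

Block : List ℕ → Set
Block g = ∃[ a ] ∃[ g′ ] g ≡ a ∷ g′ × Positive g

blocks-concat : ∀ G L W → All Block G → blocks (concat G ++ L) (map sum G ++ W) ≡ G ++ blocks L W
blocks-concat [] L W _ = refl
blocks-concat ((a ∷ g) ∷ G) L W ((_ , _ , refl , 0<a ∷ pg) ∷ bG) =
  trans (cong (λ α → blocks α (map sum ((a ∷ g) ∷ G) ++ W)) (++-assoc (a ∷ g) (concat G) L))
  (trans (blocks-∷ (a ∷ g ++ concat G ++ L) (sum (a ∷ g)) (map sum G ++ W))
  (trans (cong (λ p → proj₁ p ∷ blocks (proj₂ p) (map sum G ++ W)) (takeBlock-sum a g (concat G ++ L) 0<a pg))
         (cong ((a ∷ g) ∷_) (blocks-concat G L W bG))))

blocks-grouping : ∀ G → All Block G → blocks (concat G) (map sum G) ≡ G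
blocks-grouping G bG =
  trans (cong₂ blocks (sym (++-identityʳ (concat G))) (sym (++-identityʳ (map sum G))))
        (trans (blocks-concat G [] [] bG) (++-identityʳ G))

mergeBlocksStep : ℕ → Bool → List (List ℕ) → List (List ℕ)
mergeBlocksStep a t [] = (a ∷ []) ∷ []
mergeBlocksStep a t (g ∷ G) = if t then (a ∷ []) ∷ g ∷ G else (a ∷ g) ∷ G

mergeBlocks : ℕ → List ℕ → Cuts → List (List ℕ)
mergeBlocks a [] c = (a ∷ []) ∷ []
mergeBlocks a (b ∷ r) c = mergeBlocksStep a (firstCut c) (mergeBlocks b r (laterCuts c))

map-sum-mergeBlocks : ∀ a as c → map sum (mergeBlocks a as c) ≡ merge a as c
map-sum-mergeBlocks a [] c = cong (_∷ []) (+-identityʳ a)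
map-sum-mergeBlocks a (b ∷ r) c =
  trans (step (firstCut c) (mergeBlocks b r (laterCuts c)))
        (cong (mergeStep a (firstCut c)) (map-sum-mergeBlocks b r (laterCuts c)))
  where
  step : ∀ t G → map sum (mergeBlocksStep a t G) ≡ mergeStep a t (map sum G)
  step t [] = cong (_∷ []) (+-identityʳ a)
  step true (g ∷ G) = cong (_∷ _) (+-identityʳ a)
  step false (g ∷ G) = refl

concat-mergeBlocks : ∀ a as c → concat (mergeBlocks a as c) ≡ a ∷ as
concat-mergeBlocks a [] c = refl
concat-mergeBlocks a (b ∷ r) c =
  trans (step (firstCut c) (mergeBlocks b r (laterCuts c))) (cong (a ∷_) (concat-mergeBlocks b r (laterCuts c)))
  where
  step : ∀ t G → concat (mergeBlocksStep a t G) ≡ a ∷ concat G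
  step t [] = refl
  step true (g ∷ G) = refl
  step false (g ∷ G) = refl

mergeBlocks-blocks : ∀ {a} as c → 0 < a → Positive as → All Block (mergeBlocks a as c)
mergeBlocks-blocks {a} [] c 0<a _ = (a , [] , refl , 0<a ∷ []) ∷ []
mergeBlocks-blocks {a} (b ∷ r) c 0<a (0<b ∷ pr) =
  step (firstCut c) _ (mergeBlocks-blocks r (laterCuts c) 0<b pr)
  where
  step : ∀ t G → All Block G → All Block (mergeBlocksStep a t G)
  step t [] _ = (a , [] , refl , 0<a ∷ []) ∷ []
  step true (g ∷ G) bG = (a , [] , refl , 0<a ∷ []) ∷ bG
  step false (g ∷ G) ((_ , _ , _ , pg) ∷ bG) = (a , g , refl , 0<a ∷ pg) ∷ bG

support⇒grouping : ∀ α δ → Positive α → Support α δ →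
  ∃[ G ] All Block G × concat G ≡ α × map sum G ≡ δ
support⇒grouping [] .[] _ refl = [] , [] , refl , refl
support⇒grouping (a ∷ as) .(merge a as c) (0<a ∷ pas) (c , _ , refl) =
  mergeBlocks a as c , mergeBlocks-blocks as c 0<a pas , concat-mergeBlocks a as c , map-sum-mergeBlocks a as c

blockProduct : List (List ℕ) → ℚ
blockProduct = foldr (λ g q → blockCoeff g *ℚ q) 1ℚ

blockProduct-++ : ∀ G H → blockProduct (G ++ H) ≡ blockProduct G *ℚ blockProduct H
blockProduct-++ [] H = sym (ℚ.*-identityˡ _)
blockProduct-++ (g ∷ G) H =
  trans (cong (blockCoeff g *ℚ_) (blockProduct-++ G H)) (sym (ℚ.*-assoc (blockCoeff g) _ _))

coeffC-++ : ∀ α₁ α₂ β γ → Positive α₁ → Positive α₂ → Support α₁ β → Support α₂ γ →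
  coeffC (α₁ ++ α₂) (β ++ γ) ≡ coeffC α₁ β *ℚ coeffC α₂ γ
coeffC-++ α₁ α₂ β γ pα₁ pα₂ sβ sγ
  with G , bG , refl , refl ← support⇒grouping α₁ β pα₁ sβ
     | H , bH , refl , refl ← support⇒grouping α₂ γ pα₂ sγ = begin
  blockProduct (blocks (concat G ++ concat H) (map sum G ++ map sum H))
    ≡⟨ cong blockProduct (blocks-concat G (concat H) (map sum H) bG) ⟩
  blockProduct (G ++ blocks (concat H) (map sum H))
    ≡⟨ cong (λ B → blockProduct (G ++ B)) (blocks-grouping H bH) ⟩
  blockProduct (G ++ H)
    ≡⟨ blockProduct-++ G H ⟩
  blockProduct G *ℚ blockProduct H
    ≡⟨ cong₂ (λ B C → blockProduct B *ℚ blockProduct C) (blocks-grouping G bG) (blocks-grouping H bH) ⟨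
  blockProduct (blocks (concat G) (map sum G)) *ℚ blockProduct (blocks (concat H) (map sum H)) ∎
  where open ≡-Reasoning

-- The coproduct formula

inSupportᵇ-++ : ∀ α₁ α₂ β γ → Positive α₁ → Positive α₂ → sum β ≡ sum α₁ →
  inSupportᵇ α₁ β ∧ inSupportᵇ α₂ γ ≡ inSupportᵇ (α₁ ++ α₂) (β ++ γ)
inSupportᵇ-++ α₁ α₂ β γ pα₁ pα₂ sum≡ = true⇔true⇒≡ concatenate split
  where
  pα = All.++⁺ pα₁ pα₂
  concatenate : inSupportᵇ α₁ β ∧ inSupportᵇ α₂ γ ≡ true → inSupportᵇ (α₁ ++ α₂) (β ++ γ) ≡ true
  concatenate both with s₁ , s₂ ← ∧-true⁻ both =
    support⇒inSupportᵇ _ _ pα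
      (support-++ α₁ α₂ β γ (inSupportᵇ⇒support α₁ β pα₁ s₁) (inSupportᵇ⇒support α₂ γ pα₂ s₂))
  split : inSupportᵇ (α₁ ++ α₂) (β ++ γ) ≡ true → inSupportᵇ α₁ β ∧ inSupportᵇ α₂ γ ≡ true
  split s with sβ , sγ ← support-split α₁ α₂ β γ pα₁ pα₂ (inSupportᵇ⇒support _ _ pα s) sum≡ =
    ∧-true⁺ (support⇒inSupportᵇ α₁ β pα₁ sβ) (support⇒inSupportᵇ α₂ γ pα₂ sγ)

coeff-S-++ : ∀ α₁ α₂ β γ → Positive α₁ → Positive α₂ → sum β ≡ sum α₁ →
  coeff (S α₁) β *ℚ coeff (S α₂) γ ≡ coeff (S (α₁ ++ α₂)) (β ++ γ)
coeff-S-++ α₁ α₂ β γ pα₁ pα₂ sum≡ = begin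
  coeff (S α₁) β *ℚ coeff (S α₂) γ
    ≡⟨ cong₂ _*ℚ_ (coeff-S α₁ β) (coeff-S α₂ γ) ⟩
  when (inSupportᵇ α₁ β) (coeffC α₁ β) *ℚ when (inSupportᵇ α₂ γ) (coeffC α₂ γ)
    ≡⟨ when-∧-* (inSupportᵇ α₁ β) (inSupportᵇ α₂ γ) (coeffC α₁ β) (coeffC α₂ γ) ⟨
  when (inSupportᵇ α₁ β ∧ inSupportᵇ α₂ γ) (coeffC α₁ β *ℚ coeffC α₂ γ)
    ≡⟨ when-cong (inSupportᵇ α₁ β ∧ inSupportᵇ α₂ γ) coeffC≡ ⟨
  when (inSupportᵇ α₁ β ∧ inSupportᵇ α₂ γ) (coeffC (α₁ ++ α₂) (β ++ γ))
    ≡⟨ cong (λ b → when b (coeffC (α₁ ++ α₂) (β ++ γ))) (inSupportᵇ-++ α₁ α₂ β γ pα₁ pα₂ sum≡) ⟩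
  when (inSupportᵇ (α₁ ++ α₂) (β ++ γ)) (coeffC (α₁ ++ α₂) (β ++ γ))
    ≡⟨ coeff-S (α₁ ++ α₂) (β ++ γ) ⟨
  coeff (S (α₁ ++ α₂)) (β ++ γ) ∎
  where
  open ≡-Reasoning
  coeffC≡ : inSupportᵇ α₁ β ∧ inSupportᵇ α₂ γ ≡ true → coeffC (α₁ ++ α₂) (β ++ γ) ≡ coeffC α₁ β *ℚ coeffC α₂ γ
  coeffC≡ both with s₁ , s₂ ← ∧-true⁻ both =
    coeffC-++ α₁ α₂ β γ pα₁ pα₂ (inSupportᵇ⇒support α₁ β pα₁ s₁) (inSupportᵇ⇒support α₂ γ pα₂ s₂)

coeff-S-sum≢ : ∀ α β → Positive α → sum β ≢ sum α → coeff (S α) β ≡ 0ℚ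
coeff-S-sum≢ α β pα sum≢ =
  trans (coeff-S α β)
        (cong (λ b → when b (coeffC α β)) (¬-not (sum≢ ∘ support-sum α β ∘ inSupportᵇ⇒support α β pα)))

coeff-S-* : ∀ α₁ α₂ β γ → Positive α₁ → Positive α₂ →
  coeff (S α₁) β *ℚ coeff (S α₂) γ ≡ when (sum α₁ ≡ᵇ sum β) (coeff (S (α₁ ++ α₂)) (β ++ γ))
coeff-S-* α₁ α₂ β γ pα₁ pα₂ = when-intro (sum α₁ ≡ᵇ sum β)
  (λ e → coeff-S-++ α₁ α₂ β γ pα₁ pα₂ (sym (≡ᵇ-true⇒≡ _ _ e)))
  (λ e → trans (cong (_*ℚ coeff (S α₂) γ) (coeff-S-sum≢ α₁ β pα₁ (not-¬ e ∘ ≡⇒≡ᵇ-true _ _ ∘ sym)))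
               (ℚ.*-zeroˡ (coeff (S α₂) γ)))

+-≡ᵇ-cancelˡ : ∀ a m n → (a + m ≡ᵇ a + n) ≡ (m ≡ᵇ n)
+-≡ᵇ-cancelˡ zero m n = refl
+-≡ᵇ-cancelˡ (suc a) m n = +-≡ᵇ-cancelˡ a m n

-- Positivity makes the prefix sums of a composition distinct, so exactly one summand survives.
∑-deconcat-prefix : ∀ α₁ α₂ K → Positive (α₁ ++ α₂) →
  ∑ (λ d → when (sum (proj₁ d) ≡ᵇ sum α₁) K) (deconcat (α₁ ++ α₂)) ≡ K
∑-deconcat-prefix [] [] K _ = ℚ.+-identityʳ K
∑-deconcat-prefix [] (suc a ∷ r) K _ =
  trans (cong (K +ℚ_) (trans (∑-map (λ d → when (sum (proj₁ d) ≡ᵇ 0) K) (consFirst (suc a)) (deconcat r))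
                             (∑-zero (deconcat r) (λ _ → refl))))
        (ℚ.+-identityʳ K)
∑-deconcat-prefix [] (zero ∷ r) K (() ∷ _)
∑-deconcat-prefix (zero ∷ α₁) α₂ K (() ∷ _)
∑-deconcat-prefix (suc a ∷ α₁) α₂ K (_ ∷ pα) =
  trans (ℚ.+-identityˡ _)
  (trans (∑-map (λ d → when (sum (proj₁ d) ≡ᵇ suc a + sum α₁) K) (consFirst (suc a)) (deconcat (α₁ ++ α₂)))
  (trans (∑-cong (deconcat (α₁ ++ α₂))
                 (universal (λ d → cong (λ b → when b K) (+-≡ᵇ-cancelˡ (suc a) (sum (proj₁ d)) (sum α₁))) _))
         (∑-deconcat-prefix α₁ α₂ K pα)))

map-++⁻ : {A B : Set} (f : A → B) (G : List A) (β γ : List B) → map f G ≡ β ++ γ →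
  ∃[ G₁ ] ∃[ G₂ ] G ≡ G₁ ++ G₂ × map f G₁ ≡ β × map f G₂ ≡ γ
map-++⁻ f G [] γ eq = [] , G , refl , refl , eq
map-++⁻ f (g ∷ G) (b ∷ β) γ eq
  with refl , eq′ ← ∷-injective eq
  with G₁ , G₂ , refl , refl , refl ← map-++⁻ f G β γ eq′ = g ∷ G₁ , G₂ , refl , refl , refl

sum-concat : ∀ G → sum (concat G) ≡ sum (map sum G)
sum-concat [] = refl
sum-concat (g ∷ G) = trans (sum-++ g (concat G)) (cong (sum g +_) (sum-concat G))

support⇒prefix : ∀ α β γ → Positive α → Support α (β ++ γ) → ∃[ α₁ ] ∃[ α₂ ] α ≡ α₁ ++ α₂ × sum α₁ ≡ sum β
support⇒prefix α β γ pα s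
  with G , _ , refl , sums≡ ← support⇒grouping α (β ++ γ) pα s
  with G₁ , G₂ , refl , refl , _ ← map-++⁻ sum G β γ sums≡ =
  concat G₁ , concat G₂ , sym (concat-++ G₁ G₂) , sum-concat G₁

∑-deconcat-when : ∀ α s v c → Positive α → (v ≡ true → ∃[ α₁ ] ∃[ α₂ ] α ≡ α₁ ++ α₂ × sum α₁ ≡ s) →
  ∑ (λ d → when (sum (proj₁ d) ≡ᵇ s) (when v c)) (deconcat α) ≡ when v c
∑-deconcat-when α s true c pα prefix with α₁ , α₂ , refl , refl ← prefix refl = ∑-deconcat-prefix α₁ α₂ c pα
∑-deconcat-when α s false c pα _ = ∑-zero (deconcat α) (λ d → when-0 (sum (proj₁ d) ≡ᵇ s))

∑-deconcat-coeff : ∀ α β γ → Positive α →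
  ∑ (λ d → when (sum (proj₁ d) ≡ᵇ sum β) (coeff (S α) (β ++ γ))) (deconcat α) ≡ coeff (S α) (β ++ γ)
∑-deconcat-coeff α β γ pα =
  subst (λ K → ∑ (λ d → when (sum (proj₁ d) ≡ᵇ sum β) K) (deconcat α) ≡ K) (sym (coeff-S α (β ++ γ)))
        (∑-deconcat-when α (sum β) _ _ pα (support⇒prefix α β γ pα ∘ inSupportᵇ⇒support α (β ++ γ) pα))

deconcat-++ : ∀ α → All (λ d → proj₁ d ++ proj₂ d ≡ α) (deconcat α)
deconcat-++ [] = refl ∷ []
deconcat-++ (a ∷ r) = refl ∷ All.map⁺ (All.map (cong (a ∷_)) (deconcat-++ r))

mainTheorem3 : (α : List ℕ) → All (0 <_) α →
    (β γ : List ℕ) → coeff₂ (Δ (S α)) β γ ≡ coeff₂ (deconcatS α) β γ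
mainTheorem3 α pα β γ = begin
  coeff₂ (Δ (S α)) β γ
    ≡⟨ coeff₂-Δ (S α) β γ ⟩
  coeff (S α) (β ++ γ)
    ≡⟨ ∑-deconcat-coeff α β γ pα ⟨
  ∑ (λ d → when (sum (proj₁ d) ≡ᵇ sum β) (coeff (S α) (β ++ γ))) (deconcat α)
    ≡⟨ ∑-cong (deconcat α) (All.map (λ {d} → term {d}) (deconcat-++ α)) ⟨
  ∑ (λ d → coeff (S (proj₁ d)) β *ℚ coeff (S (proj₂ d)) γ) (deconcat α)
    ≡⟨ ∑-cong (deconcat α) (universal (λ d → coeff₂-⊗ (S (proj₁ d)) (S (proj₂ d)) β γ) _) ⟨
  ∑ (λ d → coeff₂ (S (proj₁ d) ⊗ S (proj₂ d)) β γ) (deconcat α)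
    ≡⟨ coeff₂-concatMap (λ d → S (proj₁ d) ⊗ S (proj₂ d)) (deconcat α) β γ ⟨
  coeff₂ (deconcatS α) β γ ∎
  where
  open ≡-Reasoning
  term : ∀ {d} → proj₁ d ++ proj₂ d ≡ α →
    coeff (S (proj₁ d)) β *ℚ coeff (S (proj₂ d)) γ ≡ when (sum (proj₁ d) ≡ᵇ sum β) (coeff (S α) (β ++ γ))
  term {d₁ , d₂} refl = coeff-S-* d₁ d₂ β γ (All.++⁻ˡ d₁ pα) (All.++⁻ʳ d₁ pα)
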